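{- Let $\Gamma$ be an abelian group written additively and $(G,\varphi)$ a $\Gamma$-gain graph, where $G$ is a finite loopless graph with no isolated vertices in which every connected component is a block. For each vertex $v$ let $\vec B_v$ be the bond $\delta(v)$ oriented towards $v$, and define $\pi_\varphi(v)=\varphi(\vec B_v)$. Then $\pi_\varphi$ is a $\Gamma$-quotient labeling of $G$, and for every oriented bond $\vec B$ of $G$, $\varphi(\vec B)=\pi_\varphi(\vec B)$.
   Context: A block is a connected graph with no cut vertex (under the stated assumptions, each $\delta(v)$ is a bond). A bond is a minimal nonempty edge cut; $\delta(X)$ is the set of non-loop edges with exactly one endpoint in a vertex set $X$. An oriented bond $\vec B$ is a bond $\delta(X)$ with all edges oriented away from $X$ or all towards $X$. A $\Gamma$-gain function assigns to each oriented edge $e$ a value $\varphi(e)\in\Gamma$ with $\varphi(-e)=-\varphi(e)$, and $\varphi(\vec B)=\sum_{e\in\vec B}\varphi(e)$. A $\Gamma$-quotient labeling is a map $\pi:V(G)\to\Gamma$ with $\sum_{v\in V(H)}\pi(v)=0$ for each connected component $H$; for a bond $\delta(X)$ oriented towards $X$, $\pi(\vec B)=\sum_{v\in X}\pi(v)$, and the reverse orientation gets the negative of this. -}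

module Defs where

open import Level using (Level)
open import Data.Nat using (ℕ; zero; suc)
open import Data.Fin using (Fin; zero; suc; _≟_)
open import Data.Bool using (Bool; true; false; if_then_else_; _xor_)
open import Data.Product using (Σ; ∃; _×_; _,_)
open import Data.Sum using (_⊎_)
open import Data.Unit using (⊤)
open import Relation.Nullary using (¬_)
open import Relation.Nullary.Decidable using (⌊_⌋)
open import Relation.Binary.PropositionalEquality using (_≡_; _≢_)
open import Algebra.Bundles using (AbelianGroup)

-- A finite multigraph: vertices Fin n, edges Fin m; edge e has a reference
-- orientation from src e to tgt e (parallel edges allowed; loops allowed by the
-- type, excluded by the hypothesis Loopless).
record Graph : Set where
  field
    n   : ℕ
    m   : ℕ
    src : Fin m → Fin n
    tgt : Fin m → Fin n
open Graph public

module _ (G : Graph) where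
  Joins : Fin (m G) → Fin (n G) → Fin (n G) → Set
  Joins e u w = (src G e ≡ u × tgt G e ≡ w) ⊎ (tgt G e ≡ u × src G e ≡ w)

  -- walks from u to w all of whose vertices after u satisfy ok
  data Walk (ok : Fin (n G) → Set) : Fin (n G) → Fin (n G) → Set where
    here : ∀ {u} → Walk ok u u
    step : ∀ {u v w} (e : Fin (m G)) → Joins e u v → ok v → Walk ok v w → Walk ok u w

  Reach : Fin (n G) → Fin (n G) → Set
  Reach = Walk (λ _ → ⊤)

  Loopless : Set
  Loopless = ∀ e → src G e ≢ tgt G e

  NoIsolated : Set
  NoIsolated = ∀ v → ∃ λ e → (src G e ≡ v ⊎ tgt G e ≡ v)

  -- every connected component is a block: connected (by definition of a
  -- component) and without a cut vertex, i.e. deleting any vertex x leaves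
  -- the rest of its component connected.
  ComponentsAreBlocks : Set
  ComponentsAreBlocks = ∀ x u w → u ≢ x → w ≢ x → Reach u w →
                        Walk (λ y → y ≢ x) u w

  VSet : Set
  VSet = Fin (n G) → Bool

  δ : VSet → Fin (m G) → Bool
  δ X e = X (src G e) xor X (tgt G e)

  NonemptyCut : VSet → Set
  NonemptyCut X = ∃ λ e → δ X e ≡ true

  IsBond : VSet → Set
  IsBond X = NonemptyCut X ×
             (∀ Y → NonemptyCut Y → (∀ e → δ Y e ≡ true → δ X e ≡ true) →
                    ∀ e → δ X e ≡ true → δ Y e ≡ true)

  single : Fin (n G) → VSet
  single v w = ⌊ w ≟ v ⌋

module _ {c ℓ : Level} (Γ : AbelianGroup c ℓ) where
  open AbelianGroup Γ renaming (Carrier to A)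

  sumFin : (k : ℕ) → (Fin k → A) → A
  sumFin zero    f = ε
  sumFin (suc k) f = f zero ∙ sumFin k (λ i → f (suc i))

  module _ (G : Graph) where
    -- a Γ-gain function: φ e is the gain of e in its reference orientation
    -- src → tgt; the reversed orientation has gain ⁻¹ (i.e. negative).
    GainFunction : Set c
    GainFunction = Fin (m G) → A

    gainTowards : GainFunction → VSet G → A
    gainTowards φ X = sumFin (m G) λ e →
      if δ G X e then (if X (tgt G e) then φ e else φ e ⁻¹) else ε

    gainAway : GainFunction → VSet G → A
    gainAway φ X = sumFin (m G) λ e →
      if δ G X e then (if X (src G e) then φ e else φ e ⁻¹) else ε

    sumOver : (Fin (n G) → A) → VSet G → A
    sumOver π X = sumFin (n G) λ v → if X v then π v else ε

    πφ : GainFunction → Fin (n G) → A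
    πφ φ v = gainTowards φ (single G v)

    -- Γ-quotient labeling: sum over every connected component is 0.
    -- C is (the indicator of) the component of v.
    IsQuotientLabeling : (Fin (n G) → A) → Set ℓ
    IsQuotientLabeling π = ∀ (C : VSet G) (v : Fin (n G)) →
      (∀ w → (C w ≡ true → Reach G v w) × (Reach G v w → C w ≡ true)) →
      sumOver π C ≈ ε

    quotientTowards : (Fin (n G) → A) → VSet G → A
    quotientTowards π X = sumOver π X

    quotientAway : (Fin (n G) → A) → VSet G → A
    quotientAway π X = (sumOver π X) ⁻¹

-- An edge e from s to t with gain x contributes x to π_φ(t), x⁻¹ to π_φ(s) and
-- nothing else.  Summing π_φ over any vertex set X, the two contributions of an
-- edge inside X cancel, an edge entering X leaves x, one leaving X leaves x⁻¹:
-- what remains is exactly φ of δ(X) oriented towards X.  So φ(B⃗) = π_φ(B⃗) holds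
-- for every cut, and a component C has δ(C) = ∅, whence
-- Σ_{v∈C} π_φ(v) = 0.
module Submission where

open import Defs
open import Level using (Level)
open import Algebra.Bundles using (AbelianGroup)
open import Data.Bool using (Bool; true; false; if_then_else_; _xor_)
open import Data.Bool.Properties using (xor-same; ⇔→≡)
open import Data.Fin using (Fin; zero; suc; _≟_; punchIn)
open import Data.Fin.Properties using (punchInᵢ≢i)
open import Data.Nat using (zero; suc)
open import Data.Product using (_×_; _,_; proj₁; proj₂)
open import Data.Sum using (inj₁; inj₂)
open import Data.Unit using (tt)
open import Function using (_∘_; mk⇔)
open import Relation.Nullary using (Dec; yes; no; ¬_; contradiction)
open import Relation.Nullary.Decidable using (⌊_⌋)
open import Relation.Binary.PropositionalEquality as ≡ using (_≡_; refl)

module _ (G : Graph) where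

  reach-snoc : ∀ {u v w} → Reach G u v → (e : Fin (m G)) → Joins G e v w → Reach G u w
  reach-snoc here             e j = step e j tt here
  reach-snoc (step e′ j′ _ r) e j = step e′ j′ tt (reach-snoc r e j)

  component-δ-empty : ∀ (C : VSet G) v →
    (∀ w → (C w ≡ true → Reach G v w) × (Reach G v w → C w ≡ true)) →
    ∀ e → δ G C e ≡ false
  component-δ-empty C v C-component e =
    ≡.trans (≡.cong (_xor C t) C[s]≡C[t]) (xor-same (C t))
    where
    s t : Fin (n G)
    s = src G e
    t = tgt G e
    ∈C⇒reach : ∀ w → C w ≡ true → Reach G v w
    ∈C⇒reach w = proj₁ (C-component w)
    reach⇒∈C : ∀ w → Reach G v w → C w ≡ true
    reach⇒∈C w = proj₂ (C-component w)
    C[s]≡C[t] : C s ≡ C t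
    C[s]≡C[t] = ⇔→≡ {z = true} (mk⇔
      (λ s∈C → reach⇒∈C t (reach-snoc (∈C⇒reach s s∈C) e (inj₁ (refl , refl))))
      (λ t∈C → reach⇒∈C s (reach-snoc (∈C⇒reach t t∈C) e (inj₂ (refl , refl)))))

module _ {c ℓ : Level} (Γ : AbelianGroup c ℓ) where
  open AbelianGroup Γ renaming (Carrier to A; refl to ≈-refl; sym to ≈-sym; trans to ≈-trans)
  open import Algebra.Properties.AbelianGroup Γ using (ε⁻¹≈ε; ⁻¹-involutive; ⁻¹-∙-comm)
  open import Algebra.Properties.CommutativeMonoid.Sum commutativeMonoid
    using (sum; sum-syntax; sum-cong-≋; sum-cong-≗; sum-remove; sum-replicate-zero;
           ∑-distrib-+; ∑-comm)
  open import Relation.Binary.Reasoning.Setoid setoid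

  sumFin≡sum : ∀ k (f : Fin k → A) → sumFin Γ k f ≡ sum f
  sumFin≡sum zero    f = refl
  sumFin≡sum (suc k) f = ≡.cong (f zero ∙_) (sumFin≡sum k (f ∘ suc))

  sum-⁻¹ : ∀ {k} (f : Fin k → A) → sum f ⁻¹ ≈ ∑[ i < k ] (f i ⁻¹)
  sum-⁻¹ {zero}  f = ε⁻¹≈ε
  sum-⁻¹ {suc k} f = ≈-trans (≈-sym (⁻¹-∙-comm _ _)) (∙-congˡ (sum-⁻¹ (f ∘ suc)))

  when : Bool → A → A
  when b x = if b then x else ε

  when-yes : ∀ {P : Set} (p? : Dec P) → P → ∀ x → when ⌊ p? ⌋ x ≡ x
  when-yes (yes _) p x = refl
  when-yes (no ¬p) p x = contradiction p ¬p

  when-no : ∀ {P : Set} (p? : Dec P) → ¬ P → ∀ x → when ⌊ p? ⌋ x ≡ ε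
  when-no (yes p) ¬p x = contradiction p ¬p
  when-no (no _)  ¬p x = refl

  when-comm : ∀ a b x → when a (when b x) ≡ when b (when a x)
  when-comm false false x = refl
  when-comm false true  x = refl
  when-comm true  b     x = refl

  when-cong : ∀ b {x y} → x ≈ y → when b x ≈ when b y
  when-cong true  x≈y = x≈y
  when-cong false x≈y = ≈-refl

  when-∙ : ∀ b x y → when b (x ∙ y) ≈ when b x ∙ when b y
  when-∙ true  x y = ≈-refl
  when-∙ false x y = ≈-sym (identityˡ ε)

  when-sum : ∀ b {k} (f : Fin k → A) → when b (sum f) ≈ ∑[ i < k ] when b (f i)
  when-sum true  f = ≈-refl
  when-sum false {k} f = ≈-sym (sum-replicate-zero k)

  sum-when-≟ : ∀ {k} (t : Fin k) (f : Fin k → A) → ∑[ v < k ] when ⌊ t ≟ v ⌋ (f v) ≈ f t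
  sum-when-≟ {suc k} t f = begin
    ∑[ v < suc k ] g v                      ≈⟨ sum-remove g ⟩
    g t ∙ ∑[ j < k ] g (punchIn t j)
      ≈⟨ ∙-cong (reflexive (when-yes (t ≟ t) refl (f t))) (sum-cong-≋ off-t) ⟩
    f t ∙ ∑[ j < k ] ε                      ≈⟨ ∙-congˡ (sum-replicate-zero k) ⟩
    f t ∙ ε                                 ≈⟨ identityʳ (f t) ⟩
    f t                                     ∎
    where
    g : Fin (suc k) → A
    g v = when ⌊ t ≟ v ⌋ (f v)
    off-t : ∀ j → g (punchIn t j) ≈ ε
    off-t j = reflexive (when-no (t ≟ punchIn t j) (punchInᵢ≢i t j ∘ ≡.sym) _)

  -- The gain contributed to a cut oriented towards (resp. away from) a set by an
  -- edge of gain x whose tail and head have membership s and t.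
  inflow outflow : Bool → Bool → A → A
  inflow  s t x = if s xor t then (if t then x else x ⁻¹) else ε
  outflow s t x = if s xor t then (if s then x else x ⁻¹) else ε

  inflow-noncrossing : ∀ s t x → s xor t ≡ false → inflow s t x ≡ ε
  inflow-noncrossing s t x = ≡.cong (λ b → if b then (if t then x else x ⁻¹) else ε)

  inflow≈when : ∀ s t x → inflow s t x ≈ when t x ∙ when s (x ⁻¹)
  inflow≈when true  true  x = ≈-sym (inverseʳ x)
  inflow≈when true  false x = ≈-sym (identityˡ (x ⁻¹))
  inflow≈when false true  x = ≈-sym (identityʳ x)
  inflow≈when false false x = ≈-sym (identityˡ ε)

  inflow-⁻¹ : ∀ s t x → inflow s t x ⁻¹ ≈ outflow s t x
  inflow-⁻¹ true  true  x = ε⁻¹≈ε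
  inflow-⁻¹ true  false x = ⁻¹-involutive x
  inflow-⁻¹ false true  x = ≈-refl
  inflow-⁻¹ false false x = ε⁻¹≈ε

  sum-inflow-singletons : ∀ {k} (X : Fin k → Bool) (s t : Fin k) x →
    ∑[ v < k ] when (X v) (inflow ⌊ s ≟ v ⌋ ⌊ t ≟ v ⌋ x) ≈ inflow (X s) (X t) x
  sum-inflow-singletons {k} X s t x = begin
    ∑[ v < k ] when (X v) (inflow ⌊ s ≟ v ⌋ ⌊ t ≟ v ⌋ x)
      ≈⟨ sum-cong-≋ (λ v → ≈-trans (when-cong (X v) (inflow≈when _ _ x)) (when-∙ (X v) _ _)) ⟩
    ∑[ v < k ] (when (X v) (when ⌊ t ≟ v ⌋ x) ∙ when (X v) (when ⌊ s ≟ v ⌋ (x ⁻¹)))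
      ≈⟨ ∑-distrib-+ (λ v → when (X v) (when ⌊ t ≟ v ⌋ x))
                     (λ v → when (X v) (when ⌊ s ≟ v ⌋ (x ⁻¹))) ⟩
    ∑[ v < k ] when (X v) (when ⌊ t ≟ v ⌋ x) ∙ ∑[ v < k ] when (X v) (when ⌊ s ≟ v ⌋ (x ⁻¹))
      ≈⟨ ∙-cong (sift t x) (sift s (x ⁻¹)) ⟩
    when (X t) x ∙ when (X s) (x ⁻¹)
      ≈⟨ inflow≈when (X s) (X t) x ⟨
    inflow (X s) (X t) x ∎
    where
    sift : ∀ u y → ∑[ v < k ] when (X v) (when ⌊ u ≟ v ⌋ y) ≈ when (X u) y
    sift u y = ≈-trans (reflexive (sum-cong-≗ (λ v → when-comm (X v) ⌊ u ≟ v ⌋ y)))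
                       (sum-when-≟ u (λ v → when (X v) y))

  module _ (G : Graph) (φ : GainFunction Γ G) where

    gainTowards≈sumOver-πφ : ∀ X → gainTowards Γ G φ X ≈ sumOver Γ G (πφ Γ G φ) X
    gainTowards≈sumOver-πφ X = begin
      gainTowards Γ G φ X
        ≡⟨ sumFin≡sum (m G) _ ⟩
      ∑[ e < m G ] inflow (X (s e)) (X (t e)) (φ e)
        ≈⟨ sum-cong-≋ (λ e → sum-inflow-singletons X (s e) (t e) (φ e)) ⟨
      ∑[ e < m G ] ∑[ v < n G ] when (X v) (πφ-term v e)
        ≈⟨ ∑-comm (λ e v → when (X v) (πφ-term v e)) ⟩
      ∑[ v < n G ] ∑[ e < m G ] when (X v) (πφ-term v e)
        ≈⟨ sum-cong-≋ (λ v → when-sum (X v) (πφ-term v)) ⟨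
      ∑[ v < n G ] when (X v) (∑[ e < m G ] πφ-term v e)
        ≡⟨ sum-cong-≗ (λ v → ≡.cong (when (X v)) (sumFin≡sum (m G) (πφ-term v))) ⟨
      ∑[ v < n G ] when (X v) (πφ Γ G φ v)
        ≡⟨ sumFin≡sum (n G) _ ⟨
      sumOver Γ G (πφ Γ G φ) X ∎
      where
      s t : Fin (m G) → Fin (n G)
      s = src G
      t = tgt G
      πφ-term : Fin (n G) → Fin (m G) → A
      πφ-term v e = inflow (single G v (s e)) (single G v (t e)) (φ e)

    gainAway≈gainTowards⁻¹ : ∀ X → gainAway Γ G φ X ≈ gainTowards Γ G φ X ⁻¹
    gainAway≈gainTowards⁻¹ X = begin
      gainAway Γ G φ X                    ≡⟨ sumFin≡sum (m G) _ ⟩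
      ∑[ e < m G ] outflow (X (src G e)) (X (tgt G e)) (φ e)
        ≈⟨ sum-cong-≋ (λ e → inflow-⁻¹ (X (src G e)) (X (tgt G e)) (φ e)) ⟨
      ∑[ e < m G ] (inflow-at e ⁻¹)       ≈⟨ sum-⁻¹ inflow-at ⟨
      (∑[ e < m G ] inflow-at e) ⁻¹       ≡⟨ ≡.cong _⁻¹ (sumFin≡sum (m G) inflow-at) ⟨
      gainTowards Γ G φ X ⁻¹              ∎
      where
      inflow-at : Fin (m G) → A
      inflow-at e = inflow (X (src G e)) (X (tgt G e)) (φ e)

    gainTowards-δ-empty : ∀ X → (∀ e → δ G X e ≡ false) → gainTowards Γ G φ X ≈ ε
    gainTowards-δ-empty X δ-empty = begin
      gainTowards Γ G φ X                               ≡⟨ sumFin≡sum (m G) _ ⟩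
      ∑[ e < m G ] inflow (X (src G e)) (X (tgt G e)) (φ e)
        ≈⟨ sum-cong-≋ (λ e → reflexive
             (inflow-noncrossing (X (src G e)) (X (tgt G e)) (φ e) (δ-empty e))) ⟩
      ∑[ e < m G ] ε                                    ≈⟨ sum-replicate-zero (m G) ⟩
      ε                                                 ∎

    gainAway≈sumOver-πφ⁻¹ : ∀ X → gainAway Γ G φ X ≈ sumOver Γ G (πφ Γ G φ) X ⁻¹
    gainAway≈sumOver-πφ⁻¹ X =
      ≈-trans (gainAway≈gainTowards⁻¹ X) (⁻¹-cong (gainTowards≈sumOver-πφ X))

    πφ-isQuotientLabeling : IsQuotientLabeling Γ G (πφ Γ G φ)
    πφ-isQuotientLabeling C v C-component =
      ≈-trans (≈-sym (gainTowards≈sumOver-πφ C))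
              (gainTowards-δ-empty C (component-δ-empty G C v C-component))

-- The hypotheses on G and on X are unused: in the paper they only serve to make
-- each δ(v) and δ(X) a bond.
theorem4p8 : ∀ {c ℓ : Level} (Γ : AbelianGroup c ℓ) (G : Graph) →
    Loopless G → NoIsolated G → ComponentsAreBlocks G →
    (φ : GainFunction Γ G) →
    IsQuotientLabeling Γ G (πφ Γ G φ) ×
    (∀ (X : VSet G) → IsBond G X →
      AbelianGroup._≈_ Γ (gainTowards Γ G φ X) (quotientTowards Γ G (πφ Γ G φ) X) ×
      AbelianGroup._≈_ Γ (gainAway Γ G φ X) (quotientAway Γ G (πφ Γ G φ) X))
theorem4p8 Γ G _ _ _ φ =
  πφ-isQuotientLabeling Γ G φ ,
  λ X _ → gainTowards≈sumOver-πφ Γ G φ X , gainAway≈sumOver-πφ⁻¹ Γ G φ X
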